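{- Let $p\ge 7$ be a prime. Then $$\sum_{k=1}^{p-1}\frac{H_k\, H_{k,2}}{k}\equiv \sum_{1\le i<j< k\le p-1}\frac{1}{ij^2k}+\sum_{1\le i<j< k\le p-1}\frac{1}{i^2jk}\pmod{p}.$$
   Context: $H_{n,m}=\sum_{k=1}^{n}\frac{1}{k^m}$ and $H_n=H_{n,1}$. Congruences modulo $p$ are taken in the ring of rational numbers with denominators not divisible by $p$. -}

module Defs where

open import Data.Nat as ℕ using (ℕ; zero; suc; _∸_; _^_)
open import Data.Nat.Properties using (m^n≢0)
open import Data.Nat.Divisibility using (_∣_)
open import Data.Integer as ℤ using (ℤ; +_)
open import Data.Rational using (ℚ; _/_; _+_; _-_; _*_; 0ℚ; ↥_; ↧ₙ_)
open import Relation.Nullary using (¬_)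
open import Data.Product using (_×_)

invPow : ℕ → ℕ → ℚ
invPow k m = _/_ (+ 1) (suc k ^ m) {{m^n≢0 (suc k) m}}

sum1to : ℕ → (ℕ → ℚ) → ℚ
sum1to zero    f = 0ℚ
sum1to (suc n) f = sum1to n f + f (suc n)

-- 1/k^m for k ≥ 1 (k = 0 gives 1, never used)
recip : ℕ → ℕ → ℚ
recip zero    m = (+ 1) / 1
recip (suc k) m = invPow k m

H₂ : ℕ → ℕ → ℚ
H₂ n m = sum1to n (λ k → recip k m)

H : ℕ → ℚ
H n = H₂ n 1

Σ[i<j<k≤_] : ℕ → (ℕ → ℕ → ℕ → ℚ) → ℚ
Σ[i<j<k≤ n ] f = sum1to n (λ k → sum1to (k ∸ 1) (λ j → sum1to (j ∸ 1) (λ i → f i j k)))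

-- congruence modulo p in the ring of rationals with denominator prime to p:
-- a ≡ b (mod p) iff the reduced fraction a - b has denominator not divisible
-- by p and numerator divisible by p.
_≡_[mod_] : ℚ → ℚ → ℕ → Set
a ≡ b [mod p ] = (¬ (p ∣ ↧ₙ (a - b))) × (p ∣ ℤ.∣ ↥ (a - b) ∣)

module Submission where

-- Let k⁻¹ ∈ [1, p) be the inverse of k modulo p. All fractions involved have denominators prime to p,
-- so modulo p every 1/k may be replaced by y k = k⁻¹, turning the claim into a congruence between
-- integers. Expanding H_k H_{k,2} = Σ_{i,j ≤ k} 1/(i j²), the terms with i < j < k or j < i < k are
-- exactly the right-hand side; the remaining terms (some index repeated) add up to E with
-- 2E = 2 S₁ S₃ + S₂² − S₄, where S_m = Σ_{k<p} y_k^m. As k ↦ k⁻¹ permutes [1, p), S_m = Σ_{k<p} k^m,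
-- and Faulhaber's formulas show that p divides this for m = 1, 2, 4 as soon as p > 5. Hence E ≡ 0.

open import Data.Nat as ℕ using (ℕ; zero; suc; _∸_; _≤_; _<_; z≤n; s≤s)
open import Data.Nat.Primality using (Prime)
open import Defs
open import Data.Rational as ℚ using (ℚ)

module IntegerSums where
  open import Data.Integer using (ℤ; +_; 0ℤ; _+_; _*_; _-_)
  import Data.Integer.Properties as ℤₚ
  open import Data.Product using (_×_; proj₁; proj₂)
  open import Data.Fin using (Fin; toℕ; fromℕ<; inject₁; fromℕ)
  import Data.Fin.Properties as Finₚ
  import Data.Fin.Permutation as Perm
  import Data.Nat.Properties as ℕₚ
  import Algebra.Properties.CommutativeMonoid.Sum as MonoidSum
  open import Data.Integer.Tactic.RingSolver using (solve-∀)
  open import Relation.Binary.PropositionalEquality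
  open ≡-Reasoning

  sum1toℤ : ℕ → (ℕ → ℤ) → ℤ
  sum1toℤ zero    f = 0ℤ
  sum1toℤ (suc n) f = sum1toℤ n f + f (suc n)

  sum1toℤ-cong : ∀ n {f g : ℕ → ℤ} → (∀ m → f (suc m) ≡ g (suc m)) → sum1toℤ n f ≡ sum1toℤ n g
  sum1toℤ-cong zero    f≗g = refl
  sum1toℤ-cong (suc n) f≗g = cong₂ _+_ (sum1toℤ-cong n f≗g) (f≗g n)

  sum1toℤ-distrib-+ : ∀ n (f g : ℕ → ℤ) → sum1toℤ n (λ k → f k + g k) ≡ sum1toℤ n f + sum1toℤ n g
  sum1toℤ-distrib-+ zero    f g = refl
  sum1toℤ-distrib-+ (suc n) f g = trans (cong (_+ (f (suc n) + g (suc n))) (sum1toℤ-distrib-+ n f g))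
                                        (interchange (sum1toℤ n f) (f (suc n)) (sum1toℤ n g) (g (suc n)))
    where
    interchange : ∀ a b c d → (a + c) + (b + d) ≡ (a + b) + (c + d)
    interchange = solve-∀

  sum1toℤ-distribʳ-* : ∀ n (f : ℕ → ℤ) c → sum1toℤ n (λ k → f k * c) ≡ sum1toℤ n f * c
  sum1toℤ-distribʳ-* zero    f c = refl
  sum1toℤ-distribʳ-* (suc n) f c = trans (cong (_+ f (suc n) * c) (sum1toℤ-distribʳ-* n f c))
                                         (sym (ℤₚ.*-distribʳ-+ c (sum1toℤ n f) (f (suc n))))

  pairSum : ℕ → (ℕ → ℕ → ℤ) → ℤ
  pairSum n f = sum1toℤ n (λ j → sum1toℤ (j ∸ 1) (λ i → f i j))

  tripleSum : ℕ → (ℕ → ℕ → ℕ → ℤ) → ℤ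
  tripleSum n f = sum1toℤ n (λ k → pairSum (k ∸ 1) (λ i j → f i j k))

  pairSum-distribʳ-* : ∀ n (f : ℕ → ℕ → ℤ) c → pairSum n (λ i j → f i j * c) ≡ pairSum n f * c
  pairSum-distribʳ-* n f c = trans (sum1toℤ-cong n (λ j → sum1toℤ-distribʳ-* j (λ i → f i (suc j)) c))
                                   (sum1toℤ-distribʳ-* n (λ j → sum1toℤ (j ∸ 1) (λ i → f i j)) c)

  module _ (a b : ℕ → ℤ) where

    sum1toℤ-*-sum1toℤ : ∀ n → sum1toℤ n a * sum1toℤ n b
      ≡ (pairSum n (λ i j → a i * b j) + pairSum n (λ i j → b i * a j)) + sum1toℤ n (λ k → a k * b k)
    sum1toℤ-*-sum1toℤ zero    = refl
    sum1toℤ-*-sum1toℤ (suc n) = begin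
      (A + x) * (B + y)                                     ≡⟨ expand A B x y ⟩
      A * B + ((A * y + B * x) + x * y)                     ≡⟨ cong (_+ ((A * y + B * x) + x * y)) (sum1toℤ-*-sum1toℤ n) ⟩
      ((P + Q) + S) + ((A * y + B * x) + x * y)             ≡⟨ regroup P Q S (A * y) (B * x) (x * y) ⟩
      ((P + A * y) + (Q + B * x)) + (S + x * y)             ≡⟨ cong₂ (λ u v → ((P + u) + (Q + v)) + (S + x * y))
                                                                     (sym (sum1toℤ-distribʳ-* n a y))
                                                                     (sym (sum1toℤ-distribʳ-* n b x)) ⟩
      (pairSum (suc n) (λ i j → a i * b j) + pairSum (suc n) (λ i j → b i * a j)) + sum1toℤ (suc n) (λ k → a k * b k) ∎
      where
      A B x y P Q S : ℤ
      A = sum1toℤ n a; B = sum1toℤ n b; x = a (suc n); y = b (suc n)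
      P = pairSum n (λ i j → a i * b j); Q = pairSum n (λ i j → b i * a j); S = sum1toℤ n (λ k → a k * b k)
      expand : ∀ A B x y → (A + x) * (B + y) ≡ A * B + ((A * y + B * x) + x * y)
      expand = solve-∀
      regroup : ∀ P Q S u v w → ((P + Q) + S) + ((u + v) + w) ≡ ((P + u) + (Q + v)) + (S + w)
      regroup = solve-∀

  -- The terms a i * b j of (a 1 + … + a k) (b 1 + … + b k) left over by the strict pairs i < j < k and j < i < k.
  boundaryTerms : (a b : ℕ → ℤ) → ℕ → ℤ
  boundaryTerms a b k = sum1toℤ k (λ i → a i * b i) + (a k * sum1toℤ (k ∸ 1) b + b k * sum1toℤ (k ∸ 1) a)

  sum1toℤ-prefixProducts : ∀ (a b c : ℕ → ℤ) n →
    sum1toℤ n (λ k → sum1toℤ k a * sum1toℤ k b * c k)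
      ≡ (tripleSum n (λ i j k → a i * b j * c k) + tripleSum n (λ i j k → b i * a j * c k))
        + sum1toℤ n (λ k → c k * boundaryTerms a b k)
  sum1toℤ-prefixProducts a b c n = begin
    sum1toℤ n (λ k → sum1toℤ k a * sum1toℤ k b * c k)   ≡⟨ sum1toℤ-cong n split ⟩
    sum1toℤ n (λ k → (T₁ k + T₂ k) + T₃ k)              ≡⟨ sum1toℤ-distrib-+ n (λ k → T₁ k + T₂ k) T₃ ⟩
    sum1toℤ n (λ k → T₁ k + T₂ k) + sum1toℤ n T₃        ≡⟨ cong (_+ sum1toℤ n T₃) (sum1toℤ-distrib-+ n T₁ T₂) ⟩
    (sum1toℤ n T₁ + sum1toℤ n T₂) + sum1toℤ n T₃        ∎
    where
    T₁ T₂ T₃ : ℕ → ℤ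
    T₁ k = pairSum (k ∸ 1) (λ i j → a i * b j * c k)
    T₂ k = pairSum (k ∸ 1) (λ i j → b i * a j * c k)
    T₃ k = c k * boundaryTerms a b k

    expand : ∀ A B x y z → (A + x) * (B + y) * z ≡ (A * B + ((x * B + y * A) + x * y)) * z
    expand = solve-∀
    regroup : ∀ P Q S u w z → (((P + Q) + S) + (u + w)) * z ≡ (P * z + Q * z) + z * ((S + w) + u)
    regroup = solve-∀

    split : ∀ m → sum1toℤ (suc m) a * sum1toℤ (suc m) b * c (suc m) ≡ (T₁ (suc m) + T₂ (suc m)) + T₃ (suc m)
    split m = begin
      (A + x) * (B + y) * z                                  ≡⟨ expand A B x y z ⟩
      (A * B + ((x * B + y * A) + x * y)) * z                ≡⟨ cong (λ t → (t + ((x * B + y * A) + x * y)) * z) (sum1toℤ-*-sum1toℤ a b m) ⟩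
      (((P + Q) + S) + ((x * B + y * A) + x * y)) * z        ≡⟨ regroup P Q S (x * B + y * A) (x * y) z ⟩
      (P * z + Q * z) + z * ((S + x * y) + (x * B + y * A))  ≡⟨ cong₂ (λ u v → (u + v) + z * ((S + x * y) + (x * B + y * A)))
                                                                      (sym (pairSum-distribʳ-* m (λ i j → a i * b j) z))
                                                                      (sym (pairSum-distribʳ-* m (λ i j → b i * a j) z)) ⟩
      (T₁ (suc m) + T₂ (suc m)) + T₃ (suc m)                 ∎
      where
      A B x y z P Q S : ℤ
      A = sum1toℤ m a; B = sum1toℤ m b; x = a (suc m); y = b (suc m); z = c (suc m)
      P = pairSum m (λ i j → a i * b j); Q = pairSum m (λ i j → b i * a j); S = sum1toℤ m (λ k → a k * b k)

  module _ (y : ℕ → ℤ) where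

    Σy Σy² Σy³ Σy⁴ : ℕ → ℤ
    Σy  n = sum1toℤ n y
    Σy² n = sum1toℤ n (λ k → y k * y k)
    Σy³ n = sum1toℤ n (λ k → y k * (y k * y k))
    Σy⁴ n = sum1toℤ n (λ k → (y k * y k) * (y k * y k))

    boundarySum : ℕ → ℤ
    boundarySum n = sum1toℤ n (λ k → y k * boundaryTerms y (λ i → y i * y i) k)

    boundarySum-powerSums : ∀ n → boundarySum n * + 2 + Σy⁴ n ≡ Σy n * Σy³ n * + 2 + Σy² n * Σy² n
    boundarySum-powerSums zero    = refl
    boundarySum-powerSums (suc n) = begin
      (E + v * ((s₃ + v * (v * v)) + (v * s₂ + (v * v) * s₁))) * + 2 + (s₄ + (v * v) * (v * v))  ≡⟨ split E s₁ s₂ s₃ s₄ v ⟩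
      (E * + 2 + s₄) + w                                                                      ≡⟨ cong (_+ w) (boundarySum-powerSums n) ⟩
      (s₁ * s₃ * + 2 + s₂ * s₂) + w                                                           ≡⟨ join s₁ s₂ s₃ v ⟩
      (s₁ + v) * (s₃ + v * (v * v)) * + 2 + (s₂ + v * v) * (s₂ + v * v)                       ∎
      where
      E s₁ s₂ s₃ s₄ v w : ℤ
      E = boundarySum n; s₁ = Σy n; s₂ = Σy² n; s₃ = Σy³ n; s₄ = Σy⁴ n; v = y (suc n)
      w = v * ((s₃ + v * (v * v)) + (v * s₂ + (v * v) * s₁)) * + 2 + (v * v) * (v * v)
      split : ∀ E s₁ s₂ s₃ s₄ v →
        (E + v * ((s₃ + v * (v * v)) + (v * s₂ + (v * v) * s₁))) * + 2 + (s₄ + (v * v) * (v * v))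
          ≡ (E * + 2 + s₄) + (v * ((s₃ + v * (v * v)) + (v * s₂ + (v * v) * s₁)) * + 2 + (v * v) * (v * v))
      split = solve-∀
      join : ∀ s₁ s₂ s₃ v →
        (s₁ * s₃ * + 2 + s₂ * s₂) + (v * ((s₃ + v * (v * v)) + (v * s₂ + (v * v) * s₁)) * + 2 + (v * v) * (v * v))
          ≡ (s₁ + v) * (s₃ + v * (v * v)) * + 2 + (s₂ + v * v) * (s₂ + v * v)
      join = solve-∀

  sum1toℤ-telescoping : ∀ (F g : ℤ → ℤ) → F 0ℤ ≡ 0ℤ → (∀ N → F (+ 1 + N) ≡ F N + g (+ 1 + N)) →
                        ∀ n → sum1toℤ n (λ k → g (+ k)) ≡ F (+ n)
  sum1toℤ-telescoping F g F0 step zero    = sym F0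
  sum1toℤ-telescoping F g F0 step (suc n) = begin
    sum1toℤ n (λ k → g (+ k)) + g (+ suc n) ≡⟨ cong (_+ g (+ suc n)) (sum1toℤ-telescoping F g F0 step n) ⟩
    F (+ n) + g (+ suc n)                   ≡⟨ cong (λ N → F (+ n) + g N) (ℤₚ.pos-+ 1 n) ⟩
    F (+ n) + g (+ 1 + + n)                 ≡⟨ sym (step (+ n)) ⟩
    F (+ 1 + + n)                           ≡⟨ cong F (sym (ℤₚ.pos-+ 1 n)) ⟩
    F (+ suc n)                             ∎

  sum1toℤ-id : ∀ n → sum1toℤ n (λ k → + k) * + 2 ≡ + n * (+ n + + 1)
  sum1toℤ-id n = trans (sym (sum1toℤ-distribʳ-* n (λ k → + k) (+ 2)))
                       (sum1toℤ-telescoping (λ N → N * (N + + 1)) (λ N → N * + 2) refl step n)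
    where
    step : ∀ N → (+ 1 + N) * ((+ 1 + N) + + 1) ≡ N * (N + + 1) + (+ 1 + N) * + 2
    step = solve-∀

  sum1toℤ-squares : ∀ n → sum1toℤ n (λ k → + k * + k) * + 6 ≡ + n * (+ n + + 1) * (+ 2 * + n + + 1)
  sum1toℤ-squares n = trans (sym (sum1toℤ-distribʳ-* n (λ k → + k * + k) (+ 6)))
                            (sum1toℤ-telescoping (λ N → N * (N + + 1) * (+ 2 * N + + 1)) (λ N → N * N * + 6) refl step n)
    where
    step : ∀ N → (+ 1 + N) * ((+ 1 + N) + + 1) * (+ 2 * (+ 1 + N) + + 1)
                   ≡ N * (N + + 1) * (+ 2 * N + + 1) + (+ 1 + N) * (+ 1 + N) * + 6
    step = solve-∀

  sum1toℤ-fourthPowers : ∀ n → sum1toℤ n (λ k → (+ k * + k) * (+ k * + k)) * + 30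
                                 ≡ + n * (+ n + + 1) * (+ 2 * + n + + 1) * (+ 3 * + n * + n + + 3 * + n - + 1)
  sum1toℤ-fourthPowers n = trans (sym (sum1toℤ-distribʳ-* n (λ k → (+ k * + k) * (+ k * + k)) (+ 30)))
                                 (sum1toℤ-telescoping F (λ N → (N * N) * (N * N) * + 30) refl step n)
    where
    F : ℤ → ℤ
    F N = N * (N + + 1) * (+ 2 * N + + 1) * (+ 3 * N * N + + 3 * N - + 1)
    step : ∀ N → (+ 1 + N) * ((+ 1 + N) + + 1) * (+ 2 * (+ 1 + N) + + 1) * (+ 3 * (+ 1 + N) * (+ 1 + N) + + 3 * (+ 1 + N) - + 1)
                   ≡ N * (N + + 1) * (+ 2 * N + + 1) * (+ 3 * N * N + + 3 * N - + 1)
                     + ((+ 1 + N) * (+ 1 + N)) * ((+ 1 + N) * (+ 1 + N)) * + 30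
    step = solve-∀

  open MonoidSum ℤₚ.+-0-commutativeMonoid using (sum; sum-init-last; sum-cong-≗; sum-permute)

  sum1toℤ-as-sum : ∀ n (g : ℕ → ℤ) → sum1toℤ n g ≡ sum (λ (i : Fin n) → g (suc (toℕ i)))
  sum1toℤ-as-sum zero    g = refl
  sum1toℤ-as-sum (suc n) g = sym (begin
    sum {suc n} (λ i → g (suc (toℕ i)))                                  ≡⟨ sum-init-last {n} (λ i → g (suc (toℕ i))) ⟩
    sum {n} (λ i → g (suc (toℕ (inject₁ i)))) + g (suc (toℕ (fromℕ n)))  ≡⟨ cong₂ _+_ (sum-cong-≗ {n} (λ i → cong (λ t → g (suc t)) (Finₚ.toℕ-inject₁ i)))
                                                                                      (cong (λ t → g (suc t)) (Finₚ.toℕ-fromℕ n)) ⟩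
    sum {n} (λ i → g (suc (toℕ i))) + g (suc n)                          ≡⟨ cong (_+ g (suc n)) (sym (sum1toℤ-as-sum n g)) ⟩
    sum1toℤ (suc n) g                                                ∎)

  sum1toℤ-involution : ∀ n (τ : ℕ → ℕ) →
    (∀ {k} → 1 ≤ k → k ≤ n → 1 ≤ τ k × τ k ≤ n) → (∀ {k} → 1 ≤ k → k ≤ n → τ (τ k) ≡ k) →
    ∀ (g : ℕ → ℤ) → sum1toℤ n (λ k → g (τ k)) ≡ sum1toℤ n g
  sum1toℤ-involution n τ τ-range τ-involutive g = begin
    sum1toℤ n (λ k → g (τ k))            ≡⟨ sum1toℤ-as-sum n (λ k → g (τ k)) ⟩
    sum {n} (λ i → g (τ (suc (toℕ i))))  ≡⟨ sum-cong-≗ {n} (λ i → cong g (sym (toℕ-τ̂ i))) ⟩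
    sum {n} (λ i → g (suc (toℕ (τ̂ i))))  ≡⟨ sym (sum-permute (λ i → g (suc (toℕ i))) (Perm.permutation τ̂ τ̂ τ̂-involutive τ̂-involutive)) ⟩
    sum {n} (λ i → g (suc (toℕ i)))      ≡⟨ sym (sum1toℤ-as-sum n g) ⟩
    sum1toℤ n g                          ∎
    where
    range : (i : Fin n) → 1 ≤ τ (suc (toℕ i)) × τ (suc (toℕ i)) ≤ n
    range i = τ-range (s≤s z≤n) (Finₚ.toℕ<n i)

    pred< : ∀ {t} → 1 ≤ t → t ≤ n → t ∸ 1 < n
    pred< {suc t} _ t≤n = t≤n

    suc-pred : ∀ {t} → 1 ≤ t → suc (t ∸ 1) ≡ t
    suc-pred {suc t} _ = refl

    -- τ transported along Fin n ≅ {1, …, n}, i ↦ suc (toℕ i)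
    τ̂ : Fin n → Fin n
    τ̂ i = fromℕ< (pred< (proj₁ (range i)) (proj₂ (range i)))

    toℕ-τ̂ : ∀ i → suc (toℕ (τ̂ i)) ≡ τ (suc (toℕ i))
    toℕ-τ̂ i = trans (cong suc (Finₚ.toℕ-fromℕ< _)) (suc-pred (proj₁ (range i)))

    τ̂-involutive : ∀ i → τ̂ (τ̂ i) ≡ i
    τ̂-involutive i = Finₚ.toℕ-injective (ℕₚ.suc-injective (begin
      suc (toℕ (τ̂ (τ̂ i)))  ≡⟨ toℕ-τ̂ (τ̂ i) ⟩
      τ (suc (toℕ (τ̂ i)))  ≡⟨ cong τ (toℕ-τ̂ i) ⟩
      τ (τ (suc (toℕ i)))  ≡⟨ τ-involutive (s≤s z≤n) (Finₚ.toℕ<n i) ⟩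
      suc (toℕ i)          ∎))

harmonicProductSum orderedTripleSum : ℕ → ℚ
harmonicProductSum n = sum1to n (λ k → H k ℚ.* H₂ k 2 ℚ.* recip k 1)
orderedTripleSum n = Σ[i<j<k≤ n ] (λ i j k → recip i 1 ℚ.* recip j 2 ℚ.* recip k 1)
                     ℚ.+ Σ[i<j<k≤ n ] (λ i j k → recip i 2 ℚ.* recip j 1 ℚ.* recip k 1)

module Residues (p : ℕ) (prime : Prime p) where
  open import Data.Nat using (NonZero; _<?_; nonTrivial⇒n>1)
  import Data.Nat.Properties as ℕₚ
  open import Data.Nat.Properties using (m^n≢0)
  open import Data.Nat.Divisibility as ℕᵈ using (>⇒∤) renaming (_∣_ to _∣ₙ_)
  open import Data.Nat.Coprimality as Coprime using (coprime-Bézout; prime⇒coprime; coprime-divisor; recompute)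
  open import Data.Nat.GCD using (module Bézout)
  open import Data.Nat.Primality using (euclidsLemma; prime⇒nonZero; prime⇒nonTrivial)
  open import Data.Integer using (ℤ; +_; 0ℤ; _+_; _*_; _-_; -_; _^_; ∣_∣)
  import Data.Integer.Properties as ℤₚ
  open import Data.Integer.DivMod using (_%ℕ_; _/ℕ_; a≡a%ℕn+[a/ℕn]*n; n%ℕd<d)
  open import Data.Integer.Divisibility.Signed
    using (_∣_; divides; ∣ᵤ⇒∣; ∣⇒∣ᵤ; ∣-reflexive; ∣m∣n⇒∣m+n; ∣m∣n⇒∣m-n; ∣m⇒∣-m; ∣m⇒∣m*n; ∣n⇒∣m*n)
  open import Data.Integer.Tactic.RingSolver using (solve-∀)
  open import Data.Rational as ℚ using (ℚ; mkℚ; toℚᵘ)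
  import Data.Rational.Properties as ℚₚ
  open import Data.Rational.Unnormalised as ℚᵘ using (ℚᵘ; mkℚᵘ; *≡*)
  open import Data.Product using (∃-syntax; _×_; _,_; proj₁; proj₂)
  open import Data.Sum using (inj₁; inj₂)
  open import Relation.Nullary using (¬_; yes; no; contradiction)
  open import Relation.Binary.PropositionalEquality
  open ≡-Reasoning
  open IntegerSums

  instance
    p-nonZero : NonZero p
    p-nonZero = prime⇒nonZero prime

  ∤-below : ∀ {c} → 1 ≤ c → c < p → ¬ p ∣ₙ c
  ∤-below {suc c} _ c<p = >⇒∤ c<p

  ∤1 : ¬ p ∣ₙ 1
  ∤1 = ∤-below (s≤s z≤n) (nonTrivial⇒n>1 p {{prime⇒nonTrivial prime}})

  ∤-* : ∀ {m n} → ¬ p ∣ₙ m → ¬ p ∣ₙ n → ¬ p ∣ₙ m ℕ.* n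
  ∤-* {m} {n} p∤m p∤n p∣mn with euclidsLemma m n prime p∣mn
  ... | inj₁ p∣m = p∤m p∣m
  ... | inj₂ p∣n = p∤n p∣n

  ∤ℤ-below : ∀ {c} → 1 ≤ c → c < p → ¬ + p ∣ + c
  ∤ℤ-below 1≤c c<p p∣c = ∤-below 1≤c c<p (∣⇒∣ᵤ p∣c)

  ∣-*-cancelˡ : ∀ {i j} → ¬ + p ∣ i → + p ∣ i * j → + p ∣ j
  ∣-*-cancelˡ {i} {j} p∤i p∣ij with euclidsLemma ∣ i ∣ ∣ j ∣ prime (subst (p ∣ₙ_) (ℤₚ.abs-* i j) (∣⇒∣ᵤ p∣ij))
  ... | inj₁ p∣i = contradiction (∣ᵤ⇒∣ p∣i) p∤i
  ... | inj₂ p∣j = ∣ᵤ⇒∣ p∣j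

  ∣-*-cancelʳ : ∀ {i j} → ¬ + p ∣ j → + p ∣ i * j → + p ∣ i
  ∣-*-cancelʳ {i} {j} p∤j p∣ij = ∣-*-cancelˡ p∤j (subst (+ p ∣_) (ℤₚ.*-comm i j) p∣ij)

  multiple-below-p : ∀ {i} → + p ∣ i → ∣ i ∣ < p → i ≡ 0ℤ
  multiple-below-p {i} p∣i ∣i∣<p with ∣ i ∣ in ∣i∣≡
  ... | zero  = ℤₚ.∣i∣≡0⇒i≡0 ∣i∣≡
  ... | suc _ = contradiction (subst (p ∣ₙ_) ∣i∣≡ (∣⇒∣ᵤ p∣i)) (>⇒∤ ∣i∣<p)

  residue-unique : ∀ {s t} → s < p → t < p → + p ∣ + s - + t → s ≡ t
  residue-unique {s} {t} s<p t<p p∣s-t = ℤₚ.+-injective (ℤₚ.i-j≡0⇒i≡j (+ s) (+ t) (multiple-below-p p∣s-t ∣s-t∣<p))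
    where
    ∣s-t∣<p : ∣ + s - + t ∣ < p
    ∣s-t∣<p = ℕₚ.≤-<-trans (subst (λ i → ∣ i ∣ ≤ s ℕ.⊔ t) (sym (ℤₚ.m-n≡m⊖n s t)) (ℤₚ.∣m⊝n∣≤m⊔n s t)) (ℕₚ.⊔-lub s<p t<p)

  IsInverse : ℕ → ℕ → Set
  IsInverse k s = (1 ≤ s × s < p) × + p ∣ + k * + s - + 1

  pos-affine : ∀ a b c d e → a ℕ.+ b ℕ.* c ≡ d ℕ.* e → + a + + b * + c ≡ + d * + e
  pos-affine a b c d e eq = begin
    + a + + b * + c      ≡⟨ cong (λ t → + a + t) (sym (ℤₚ.pos-* b c)) ⟩
    + a + + (b ℕ.* c)    ≡⟨ sym (ℤₚ.pos-+ a (b ℕ.* c)) ⟩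
    + (a ℕ.+ b ℕ.* c)    ≡⟨ cong +_ eq ⟩
    + (d ℕ.* e)          ≡⟨ ℤₚ.pos-* d e ⟩
    + d * + e            ∎

  integer-inverse : ∀ {k} → 1 ≤ k → k < p → ∃[ u ] + p ∣ + k * u - + 1
  integer-inverse {suc k} _ k<p with coprime-Bézout (prime⇒coprime prime k<p)
  ... | Bézout.+- x y 1+yk≡xp = - + y , divides (- + x) (begin
    + suc k * - + y - + 1  ≡⟨ negate (+ suc k) (+ y) ⟩
    - (+ 1 + + y * + suc k) ≡⟨ cong -_ (pos-affine 1 y (suc k) x p 1+yk≡xp) ⟩
    - (+ x * + p)          ≡⟨ ℤₚ.neg-distribˡ-* (+ x) (+ p) ⟩
    - + x * + p            ∎)
    where
    negate : ∀ k y → k * - y - + 1 ≡ - (+ 1 + y * k)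
    negate = solve-∀
  ... | Bézout.-+ x y 1+xp≡yk = + y , divides (+ x) (begin
    + suc k * + y - + 1    ≡⟨ cong (_- + 1) (ℤₚ.*-comm (+ suc k) (+ y)) ⟩
    + y * + suc k - + 1    ≡⟨ cong (_- + 1) (sym (pos-affine 1 x p y (suc k) 1+xp≡yk)) ⟩
    + 1 + + x * + p - + 1  ≡⟨ cancel (+ x * + p) ⟩
    + x * + p              ∎)
    where
    cancel : ∀ a → + 1 + a - + 1 ≡ a
    cancel = solve-∀

  inverse-exists : ∀ {k} → 1 ≤ k → k < p → ∃[ s ] IsInverse k s
  inverse-exists {k} 1≤k k<p with integer-inverse 1≤k k<p
  ... | u , p∣ku-1 = s , (positive s p∣ks-1 , n%ℕd<d u p) , p∣ks-1
    where
    s : ℕ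
    s = u %ℕ p
    q : ℤ
    q = u /ℕ p

    p∣ks-1 : + p ∣ + k * + s - + 1
    p∣ks-1 = subst (+ p ∣_) (reduce (+ k) (+ s) q (+ p))
               (∣m∣n⇒∣m-n (subst (λ t → + p ∣ + k * t - + 1) (a≡a%ℕn+[a/ℕn]*n u p) p∣ku-1)
                          (∣n⇒∣m*n (+ k * q) (∣-reflexive refl)))
      where
      reduce : ∀ k s q p → (k * (s + q * p) - + 1) - k * q * p ≡ k * s - + 1
      reduce = solve-∀

    positive : ∀ t → + p ∣ + k * + t - + 1 → 1 ≤ t
    positive zero    p∣-1 = contradiction (∣⇒∣ᵤ (subst (λ i → + p ∣ i - + 1) (ℤₚ.*-zeroʳ (+ k)) p∣-1)) ∤1
    positive (suc t) _    = s≤s z≤n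

  -- junk value 0 outside [1, p)
  inverse : ℕ → ℕ
  inverse zero = zero
  inverse (suc k) with suc k <? p
  ... | yes k<p = proj₁ (inverse-exists (s≤s z≤n) k<p)
  ... | no  _   = zero

  inverse-isInverse : ∀ {k} → 1 ≤ k → k < p → IsInverse k (inverse k)
  inverse-isInverse {suc k} _ k<p with suc k <? p
  ... | yes k<p′ = proj₂ (inverse-exists (s≤s z≤n) k<p′)
  ... | no  k≮p  = contradiction k<p k≮p

  inverse-unique : ∀ {k s t} → 1 ≤ k → k < p → s < p → t < p →
                   + p ∣ + k * + s - + 1 → + p ∣ + k * + t - + 1 → s ≡ t
  inverse-unique {k} {s} {t} 1≤k k<p s<p t<p p∣ks-1 p∣kt-1 = residue-unique s<p t<p
    (∣-*-cancelˡ (∤ℤ-below 1≤k k<p) (subst (+ p ∣_) (difference (+ k) (+ s) (+ t)) (∣m∣n⇒∣m-n p∣ks-1 p∣kt-1)))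
    where
    difference : ∀ k s t → (k * s - + 1) - (k * t - + 1) ≡ k * (s - t)
    difference = solve-∀

  inverse-involutive : ∀ {k} → 1 ≤ k → k < p → inverse (inverse k) ≡ k
  inverse-involutive {k} 1≤k k<p with inverse-isInverse 1≤k k<p
  ... | (1≤s , s<p) , p∣ks-1 with inverse-isInverse 1≤s s<p
  ... | (_ , s⁻¹<p) , p∣ss⁻¹-1 =
    inverse-unique 1≤s s<p s⁻¹<p k<p p∣ss⁻¹-1 (subst (λ i → + p ∣ i - + 1) (ℤₚ.*-comm (+ k) (+ inverse k)) p∣ks-1)

  infix 4 _≋ᵘ_ _≋_

  record _≋ᵘ_ (u : ℚᵘ) (z : ℤ) : Set where
    constructor mk≋ᵘ
    field
      ∤denominator : ¬ p ∣ₙ ℚᵘ.↧ₙ u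
      ∣numerator   : + p ∣ ℚᵘ.↥ u - z * ℚᵘ.↧ u

  record _≋_ (x : ℚ) (z : ℤ) : Set where
    constructor mk≋
    field
      ∤denominator : ¬ p ∣ₙ ℚ.↧ₙ x
      ∣numerator   : + p ∣ ℚ.↥ x - z * ℚ.↧ x

  ≋⇒≋ᵘ : ∀ {x z} → x ≋ z → toℚᵘ x ≋ᵘ z
  ≋⇒≋ᵘ {mkℚ _ _ _} (mk≋ p∤d p∣n-zd) = mk≋ᵘ p∤d p∣n-zd

  ≋ᵘ-+ : ∀ {u v z w} → u ≋ᵘ z → v ≋ᵘ w → u ℚᵘ.+ v ≋ᵘ z + w
  ≋ᵘ-+ {mkℚᵘ a b} {mkℚᵘ c d} {z} {w} (mk≋ᵘ p∤B p∣a-zB) (mk≋ᵘ p∤D p∣c-wD) =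
    mk≋ᵘ (∤-* p∤B p∤D) (subst (+ p ∣_) (sym numerator) (∣m∣n⇒∣m+n (∣m⇒∣m*n D p∣a-zB) (∣m⇒∣m*n B p∣c-wD)))
    where
    B D : ℤ
    B = + suc b
    D = + suc d
    regroup : ∀ a c z w B D → (a * D + c * B) - (z + w) * (B * D) ≡ (a - z * B) * D + (c - w * D) * B
    regroup = solve-∀
    numerator : (a * D + c * B) - (z + w) * + (suc b ℕ.* suc d) ≡ (a - z * B) * D + (c - w * D) * B
    numerator = trans (cong (λ t → (a * D + c * B) - (z + w) * t) (ℤₚ.pos-* (suc b) (suc d))) (regroup a c z w B D)

  ≋ᵘ-* : ∀ {u v z w} → u ≋ᵘ z → v ≋ᵘ w → u ℚᵘ.* v ≋ᵘ z * w
  ≋ᵘ-* {mkℚᵘ a b} {mkℚᵘ c d} {z} {w} (mk≋ᵘ p∤B p∣a-zB) (mk≋ᵘ p∤D p∣c-wD) =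
    mk≋ᵘ (∤-* p∤B p∤D) (subst (+ p ∣_) (sym numerator) (∣m∣n⇒∣m+n (∣m⇒∣m*n c p∣a-zB) (∣n⇒∣m*n (z * B) p∣c-wD)))
    where
    B D : ℤ
    B = + suc b
    D = + suc d
    regroup : ∀ a c z w B D → a * c - (z * w) * (B * D) ≡ (a - z * B) * c + (z * B) * (c - w * D)
    regroup = solve-∀
    numerator : a * c - (z * w) * + (suc b ℕ.* suc d) ≡ (a - z * B) * c + (z * B) * (c - w * D)
    numerator = trans (cong (λ t → a * c - (z * w) * t) (ℤₚ.pos-* (suc b) (suc d))) (regroup a c z w B D)

  ≋ᵘ-neg : ∀ {u z} → u ≋ᵘ z → ℚᵘ.- u ≋ᵘ - z
  ≋ᵘ-neg {mkℚᵘ a b} {z} (mk≋ᵘ p∤B p∣a-zB) = mk≋ᵘ p∤B (subst (+ p ∣_) (negate a z (+ suc b)) (∣m⇒∣-m p∣a-zB))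
    where
    negate : ∀ a z B → - (a - z * B) ≡ - a - - z * B
    negate = solve-∀

  ≋-from-≃ : ∀ x {u z} → toℚᵘ x ℚᵘ.≃ u → u ≋ᵘ z → x ≋ z
  ≋-from-≃ (mkℚ n d coprime) {mkℚᵘ a b} {z} (*≡* nB≡aD) (mk≋ᵘ p∤B p∣a-zB) = mk≋ p∤D p∣n-zD
    where
    B D : ℤ
    B = + suc b
    D = + suc d

    D∣B : suc d ∣ₙ suc b
    D∣B = coprime-divisor (Coprime.sym (recompute coprime))
            (ℕᵈ.divides ∣ a ∣ (trans (sym (ℤₚ.abs-* n B)) (trans (cong ∣_∣ nB≡aD) (ℤₚ.abs-* a D))))

    p∤D : ¬ p ∣ₙ suc d
    p∤D p∣D = p∤B (ℕᵈ.∣-trans p∣D D∣B)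

    expand : ∀ n z D B → (n - z * D) * B ≡ n * B - z * D * B
    expand = solve-∀
    regroup : ∀ a z D B → a * D - z * D * B ≡ (a - z * B) * D
    regroup = solve-∀

    p∣n-zD : + p ∣ n - z * D
    p∣n-zD = ∣-*-cancelʳ (λ p∣B → p∤B (∣⇒∣ᵤ p∣B)) (subst (+ p ∣_) (sym (begin
      (n - z * D) * B      ≡⟨ expand n z D B ⟩
      n * B - z * D * B    ≡⟨ cong (_- z * D * B) nB≡aD ⟩
      a * D - z * D * B    ≡⟨ regroup a z D B ⟩
      (a - z * B) * D      ∎)) (∣m⇒∣m*n D p∣a-zB))

  ≋-+ : ∀ {x y z w} → x ≋ z → y ≋ w → x ℚ.+ y ≋ z + w
  ≋-+ {x} {y} x≋z y≋w = ≋-from-≃ (x ℚ.+ y) (ℚₚ.toℚᵘ-homo-+ x y) (≋ᵘ-+ (≋⇒≋ᵘ x≋z) (≋⇒≋ᵘ y≋w))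

  ≋-* : ∀ {x y z w} → x ≋ z → y ≋ w → x ℚ.* y ≋ z * w
  ≋-* {x} {y} x≋z y≋w = ≋-from-≃ (x ℚ.* y) (ℚₚ.toℚᵘ-homo-* x y) (≋ᵘ-* (≋⇒≋ᵘ x≋z) (≋⇒≋ᵘ y≋w))

  ≋-sub : ∀ {x y z w} → x ≋ z → y ≋ w → x ℚ.- y ≋ z - w
  ≋-sub {x} {y} x≋z y≋w = ≋-+ x≋z (≋-from-≃ (ℚ.- y) (ℚₚ.toℚᵘ-homo‿- y) (≋ᵘ-neg (≋⇒≋ᵘ y≋w)))

  ≋-/ : ∀ i n .{{_ : NonZero n}} {z} → ¬ p ∣ₙ n → + p ∣ i - z * + n → i ℚ./ n ≋ z
  ≋-/ i (suc d) p∤n p∣i-zn = ≋-from-≃ (i ℚ./ suc d) (ℚₚ.toℚᵘ-fromℚᵘ (mkℚᵘ i d)) (mk≋ᵘ p∤n p∣i-zn)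

  ≋-sum1to : ∀ n {f : ℕ → ℚ} {g : ℕ → ℤ} → (∀ {k} → 1 ≤ k → k ≤ n → f k ≋ g k) → sum1to n f ≋ sum1toℤ n g
  ≋-sum1to zero    f≋g = mk≋ ∤1 (divides 0ℤ refl)
  ≋-sum1to (suc n) f≋g = ≋-+ (≋-sum1to n (λ 1≤k k≤n → f≋g 1≤k (ℕₚ.m≤n⇒m≤1+n k≤n))) (f≋g (s≤s z≤n) ℕₚ.≤-refl)

  ≋⇒≡[mod] : ∀ x y {z} → x ℚ.- y ≋ z → + p ∣ z → x ≡ y [mod p ]
  ≋⇒≡[mod] x y {z} (mk≋ p∤d p∣n-zd) p∣z =
    p∤d , ∣⇒∣ᵤ (subst (+ p ∣_) (cancel (ℚ.↥ (x ℚ.- y)) z (ℚ.↧ (x ℚ.- y))) (∣m∣n⇒∣m+n p∣n-zd (∣m⇒∣m*n _ p∣z)))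
    where
    cancel : ∀ n z d → (n - z * d) + z * d ≡ n
    cancel = solve-∀

  ≋-respʳ : ∀ {x z w} → z ≡ w → x ≋ z → x ≋ w
  ≋-respʳ refl x≋z = x≋z

  ∤-^ : ∀ {k} m → ¬ p ∣ₙ k → ¬ p ∣ₙ k ℕ.^ m
  ∤-^ zero    p∤k = ∤1
  ∤-^ (suc m) p∤k = ∤-* p∤k (∤-^ m p∤k)

  pos-^ : ∀ k m → + (k ℕ.^ m) ≡ (+ k) ^ m
  pos-^ k zero    = refl
  pos-^ k (suc m) = trans (ℤₚ.pos-* k (k ℕ.^ m)) (cong (+ k *_) (pos-^ k m))

  inverse-^ : ∀ {k s} m → + p ∣ k * s - + 1 → + p ∣ + 1 - s ^ m * k ^ m
  inverse-^ zero    _       = divides 0ℤ refl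
  inverse-^ {k} {s} (suc m) p∣ks-1 = subst (+ p ∣_) (sym (step k s (s ^ m) (k ^ m)))
    (∣m∣n⇒∣m-n (inverse-^ m p∣ks-1) (∣n⇒∣m*n (s ^ m * k ^ m) p∣ks-1))
    where
    step : ∀ k s S K → + 1 - (s * S) * (k * K) ≡ (+ 1 - S * K) - S * K * (k * s - + 1)
    step = solve-∀

  recip-≋ : ∀ m {k} → 1 ≤ k → k < p → recip k m ≋ (+ inverse k) ^ m
  recip-≋ m {suc k} 1≤k k<p = ≋-/ (+ 1) (suc k ℕ.^ m) {{m^n≢0 (suc k) m}} (∤-^ m (∤-below 1≤k k<p))
    (subst (λ K → + p ∣ + 1 - (+ inverse (suc k)) ^ m * K) (sym (pos-^ (suc k) m))
      (inverse-^ m (proj₂ (inverse-isInverse 1≤k k<p))))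

  ≋-tripleSum : ∀ n {f : ℕ → ℕ → ℕ → ℚ} {g : ℕ → ℕ → ℕ → ℤ} →
                (∀ {i j k} → 1 ≤ i → i ≤ n → 1 ≤ j → j ≤ n → 1 ≤ k → k ≤ n → f i j k ≋ g i j k) →
                Σ[i<j<k≤ n ] f ≋ tripleSum n g
  ≋-tripleSum n f≋g =
    ≋-sum1to n λ 1≤k k≤n → ≋-sum1to _ λ 1≤j j<k → ≋-sum1to _ λ 1≤i i<j →
      let j≤n = below j<k k≤n in f≋g 1≤i (below i<j j≤n) 1≤j j≤n 1≤k k≤n
    where
    below : ∀ {i j m} → i ≤ j ∸ 1 → j ≤ m → i ≤ m
    below {j = j} i≤j-1 j≤m = ℕₚ.≤-trans i≤j-1 (ℕₚ.≤-trans (ℕₚ.m∸n≤m j 1) j≤m)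

  inverseℤ : ℕ → ℤ
  inverseℤ k = + inverse k

  recip₁-≋ : ∀ {k} → 1 ≤ k → k < p → recip k 1 ≋ inverseℤ k
  recip₁-≋ 1≤k k<p = ≋-respʳ (ℤₚ.^-identityʳ _) (recip-≋ 1 1≤k k<p)

  recip₂-≋ : ∀ {k} → 1 ≤ k → k < p → recip k 2 ≋ inverseℤ k * inverseℤ k
  recip₂-≋ {k} 1≤k k<p = ≋-respʳ (cong (inverseℤ k *_) (ℤₚ.*-identityʳ _)) (recip-≋ 2 1≤k k<p)

  harmonicDifference-≋ : ∀ {n} → n < p → harmonicProductSum n ℚ.- orderedTripleSum n ≋ boundarySum inverseℤ n
  harmonicDifference-≋ {n} n<p = ≋-respʳ difference (≋-sub prefixProducts-≋ (≋-+ (≋-tripleSum n triple₁-≋) (≋-tripleSum n triple₂-≋)))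
    where
    a b : ℕ → ℤ
    a = inverseℤ
    b k = inverseℤ k * inverseℤ k

    <p : ∀ {k} → k ≤ n → k < p
    <p k≤n = ℕₚ.≤-<-trans k≤n n<p

    prefixProducts-≋ : harmonicProductSum n ≋ sum1toℤ n (λ k → sum1toℤ k a * sum1toℤ k b * a k)
    prefixProducts-≋ = ≋-sum1to n λ 1≤k k≤n →
      ≋-* (≋-* (≋-sum1to _ λ 1≤i i≤k → recip₁-≋ 1≤i (<p (ℕₚ.≤-trans i≤k k≤n)))
               (≋-sum1to _ λ 1≤i i≤k → recip₂-≋ 1≤i (<p (ℕₚ.≤-trans i≤k k≤n))))
          (recip₁-≋ 1≤k (<p k≤n))

    triple₁-≋ : ∀ {i j k} → 1 ≤ i → i ≤ n → 1 ≤ j → j ≤ n → 1 ≤ k → k ≤ n →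
                recip i 1 ℚ.* recip j 2 ℚ.* recip k 1 ≋ a i * b j * a k
    triple₁-≋ 1≤i i≤n 1≤j j≤n 1≤k k≤n =
      ≋-* (≋-* (recip₁-≋ 1≤i (<p i≤n)) (recip₂-≋ 1≤j (<p j≤n))) (recip₁-≋ 1≤k (<p k≤n))

    triple₂-≋ : ∀ {i j k} → 1 ≤ i → i ≤ n → 1 ≤ j → j ≤ n → 1 ≤ k → k ≤ n →
                recip i 2 ℚ.* recip j 1 ℚ.* recip k 1 ≋ b i * a j * a k
    triple₂-≋ 1≤i i≤n 1≤j j≤n 1≤k k≤n =
      ≋-* (≋-* (recip₂-≋ 1≤i (<p i≤n)) (recip₁-≋ 1≤j (<p j≤n))) (recip₁-≋ 1≤k (<p k≤n))

    cancel : ∀ T₁ T₂ E → ((T₁ + T₂) + E) - (T₁ + T₂) ≡ E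
    cancel = solve-∀

    difference : sum1toℤ n (λ k → sum1toℤ k a * sum1toℤ k b * a k)
                   - (tripleSum n (λ i j k → a i * b j * a k) + tripleSum n (λ i j k → b i * a j * a k))
                 ≡ boundarySum inverseℤ n
    difference = trans (cong (_- (T₁ + T₂)) (sum1toℤ-prefixProducts a b a n)) (cancel T₁ T₂ (boundarySum inverseℤ n))
      where
      T₁ T₂ : ℤ
      T₁ = tripleSum n (λ i j k → a i * b j * a k)
      T₂ = tripleSum n (λ i j k → b i * a j * a k)

  p-1<p : p ∸ 1 < p
  p-1<p = ∸1< p
    where
    ∸1< : ∀ m .{{_ : NonZero m}} → m ∸ 1 < m
    ∸1< (suc m) = ℕₚ.n<1+n m

  ≤p-1⇒<p : ∀ {k} → k ≤ p ∸ 1 → k < p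
  ≤p-1⇒<p k≤p-1 = ℕₚ.≤-<-trans k≤p-1 p-1<p

  sum1toℤ-inverse : ∀ (g : ℕ → ℤ) → sum1toℤ (p ∸ 1) (λ k → g (inverse k)) ≡ sum1toℤ (p ∸ 1) g
  sum1toℤ-inverse = sum1toℤ-involution (p ∸ 1) inverse range (λ 1≤k k≤p-1 → inverse-involutive 1≤k (≤p-1⇒<p k≤p-1))
    where
    <⇒≤∸1 : ∀ {k m} → k < m → k ≤ m ∸ 1
    <⇒≤∸1 (s≤s k≤m) = k≤m
    range : ∀ {k} → 1 ≤ k → k ≤ p ∸ 1 → 1 ≤ inverse k × inverse k ≤ p ∸ 1
    range 1≤k k≤p-1 with inverse-isInverse 1≤k (≤p-1⇒<p k≤p-1)
    ... | (1≤s , s<p) , _ = 1≤s , <⇒≤∸1 s<p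

  ∣-*-cancel-small : ∀ {x} c → 1 ≤ c → c ≤ 6 → 6 < p → + p ∣ x * + c → + p ∣ x
  ∣-*-cancel-small c 1≤c c≤6 6<p = ∣-*-cancelʳ (∤ℤ-below 1≤c (ℕₚ.≤-<-trans c≤6 6<p))

  p∣[p-1]p : + p ∣ + (p ∸ 1) * (+ (p ∸ 1) + + 1)
  p∣[p-1]p = ∣n⇒∣m*n (+ (p ∸ 1)) (∣-reflexive (sym p-1+1≡p))
    where
    p-1+1≡p : + (p ∸ 1) + + 1 ≡ + p
    p-1+1≡p = trans (sym (ℤₚ.pos-+ (p ∸ 1) 1)) (cong +_ (ℕₚ.m∸n+n≡m (ℕₚ.≤-<-trans z≤n p-1<p)))

  p∣sum1toℤ-id : 6 < p → + p ∣ sum1toℤ (p ∸ 1) (λ k → + k)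
  p∣sum1toℤ-id 6<p = ∣-*-cancel-small 2 (s≤s z≤n) (s≤s (s≤s z≤n)) 6<p
    (subst (+ p ∣_) (sym (sum1toℤ-id (p ∸ 1))) p∣[p-1]p)

  p∣sum1toℤ-squares : 6 < p → + p ∣ sum1toℤ (p ∸ 1) (λ k → + k * + k)
  p∣sum1toℤ-squares 6<p = ∣-*-cancel-small 6 (s≤s z≤n) ℕₚ.≤-refl 6<p
    (subst (+ p ∣_) (sym (sum1toℤ-squares (p ∸ 1))) (∣m⇒∣m*n _ p∣[p-1]p))

  p∣sum1toℤ-fourthPowers : 6 < p → + p ∣ sum1toℤ (p ∸ 1) (λ k → (+ k * + k) * (+ k * + k))
  p∣sum1toℤ-fourthPowers 6<p = ∣-*-cancel-small 6 (s≤s z≤n) ℕₚ.≤-refl 6<p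
    (∣-*-cancel-small 5 (s≤s z≤n) (s≤s (s≤s (s≤s (s≤s (s≤s z≤n))))) 6<p
      (subst (+ p ∣_) (trans (sym (sum1toℤ-fourthPowers (p ∸ 1))) (thirty S)) (∣m⇒∣m*n _ (∣m⇒∣m*n _ p∣[p-1]p))))
    where
    S : ℤ
    S = sum1toℤ (p ∸ 1) (λ k → (+ k * + k) * (+ k * + k))
    thirty : ∀ S → S * + 30 ≡ S * + 6 * + 5
    thirty = solve-∀

  boundarySum-divisible : 6 < p → + p ∣ boundarySum inverseℤ (p ∸ 1)
  boundarySum-divisible 6<p = ∣-*-cancel-small 2 (s≤s z≤n) (s≤s (s≤s z≤n)) 6<p
    (subst (+ p ∣_) twice-boundarySum
      (∣m∣n⇒∣m-n (∣m∣n⇒∣m+n (∣m⇒∣m*n (+ 2) (∣m⇒∣m*n S₃ p∣S₁)) (∣m⇒∣m*n S₂ p∣S₂)) p∣S₄))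
    where
    S₁ S₂ S₃ S₄ E : ℤ
    S₁ = Σy inverseℤ (p ∸ 1)
    S₂ = Σy² inverseℤ (p ∸ 1)
    S₃ = Σy³ inverseℤ (p ∸ 1)
    S₄ = Σy⁴ inverseℤ (p ∸ 1)
    E = boundarySum inverseℤ (p ∸ 1)

    p∣S₁ : + p ∣ S₁
    p∣S₁ = subst (+ p ∣_) (sym (sum1toℤ-inverse (λ t → + t))) (p∣sum1toℤ-id 6<p)
    p∣S₂ : + p ∣ S₂
    p∣S₂ = subst (+ p ∣_) (sym (sum1toℤ-inverse (λ t → + t * + t))) (p∣sum1toℤ-squares 6<p)
    p∣S₄ : + p ∣ S₄
    p∣S₄ = subst (+ p ∣_) (sym (sum1toℤ-inverse (λ t → (+ t * + t) * (+ t * + t)))) (p∣sum1toℤ-fourthPowers 6<p)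

    cancel : ∀ a b → (a + b) - b ≡ a
    cancel = solve-∀
    twice-boundarySum : (S₁ * S₃ * + 2 + S₂ * S₂) - S₄ ≡ E * + 2
    twice-boundarySum = trans (cong (_- S₄) (sym (boundarySum-powerSums inverseℤ (p ∸ 1)))) (cancel (E * + 2) S₄)

open import Data.Nat using (ℕ; _≥_; _∸_)
open import Data.Rational using (_+_; _*_)

lemma2p4 : (p : ℕ) → Prime p → p ≥ 7 →
    sum1to (p ∸ 1) (λ k → H k * H₂ k 2 * recip k 1)
    ≡ Σ[i<j<k≤ p ∸ 1 ] (λ i j k → recip i 1 * recip j 2 * recip k 1)
    + Σ[i<j<k≤ p ∸ 1 ] (λ i j k → recip i 2 * recip j 1 * recip k 1)
    [mod p ]
lemma2p4 p p-prime p≥7 =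
  ≋⇒≡[mod] (harmonicProductSum (p ∸ 1)) (orderedTripleSum (p ∸ 1)) (harmonicDifference-≋ p-1<p) (boundarySum-divisible p≥7)
  where open Residues p p-prime
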